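{- Let $G$ be a finite simple connected graph with $N_0$ vertices, $E_0$ edges and circuit rank $r=E_0-N_0+1$. For every $n>0$, the Kemeny constant of the iterated subdivision graph satisfies $$K(s^n(G))=4K(s^{n-1}(G))+r-\frac12,$$ and consequently $$K(s^n(G))=4^nK(G)+\frac{4^n-1}{3}\left(r-\frac12\right).$$
   Context: The subdivision graph $s(H)$ of a graph $H$ is obtained from $H$ by inserting one new vertex on every edge of $H$; $s^0(G)=G$ and $s^n(G)=s(s^{n-1}(G))$. For a connected graph $H$, the Kemeny constant $K(H)$ is the expected number of steps for a simple (unbiased) random walk on $H$ started at a vertex $i$ to hit a target vertex $j$ chosen at random according to the stationary distribution of the walk ($\pi_j=d_j/\sum_k d_k$), with hitting time $0$ if $j=i$; this quantity does not depend on $i$. Equivalently, $K(H)=\sum_{k\geqslant 2}1/\lambda_k$, where $0=\lambda_1<\lambda_2\leqslant\cdots$ are the eigenvalues of the normalized Laplacian $I-D^{ -1/2}AD^{ -1/2}$ of $H$. -}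

module Defs where

open import Data.Nat as ℕ using (ℕ; zero; suc; _<_)
open import Data.Fin using (Fin; toℕ; _↑ˡ_; _↑ʳ_; _≟_)
open import Data.List using (List; []; _∷_; length; lookup; allFin; concatMap; foldr; map)
open import Data.List.Relation.Unary.All using (All)
open import Data.List.Relation.Unary.Unique.Propositional using (Unique)
open import Data.List.Membership.Propositional using (_∈_)
open import Data.Product using (Σ; _×_; _,_; proj₁; proj₂)
open import Data.Sum using (_⊎_)
open import Data.Integer using (+_)
open import Data.Rational using (ℚ; _+_; _*_; _/_; 0ℚ)
open import Relation.Nullary using (¬_; yes; no)
open import Relation.Binary.PropositionalEquality using (_≡_; _≢_)
open import Relation.Binary.Construct.Closure.ReflexiveTransitive using (Star)

ℕ→ℚ : ℕ → ℚ
ℕ→ℚ n = (+ n) / 1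

-- A (multi)graph on vertex set Fin N, given by its list of edges {u,v}.
record Graph : Set where
  constructor graph
  field
    N     : ℕ
    edges : List (Fin N × Fin N)
open Graph public

Simple : Graph → Set
Simple G = All (λ e → toℕ (proj₁ e) < toℕ (proj₂ e)) (edges G) × Unique (edges G)

Adj : (G : Graph) → Fin (N G) → Fin (N G) → Set
Adj G u v = ((u , v) ∈ edges G) ⊎ ((v , u) ∈ edges G)

Connected : Graph → Set
Connected G = ∀ u v → Star (Adj G) u v

nEdges : Graph → ℕ
nEdges G = length (edges G)

-- subdivision s(G): vertices Fin (N + E); new vertex N + k sits on the k-th edge
subdivide : Graph → Graph
subdivide (graph n es) =
  graph (n ℕ.+ length es)
        (concatMap (λ k → newEdges k (lookup es k)) (allFin (length es)))
  where
  newEdges : Fin (length es) → Fin n × Fin n → List (Fin (n ℕ.+ length es) × Fin (n ℕ.+ length es))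
  newEdges k (u , v) = (u ↑ˡ length es , n ↑ʳ k) ∷ (v ↑ˡ length es , n ↑ʳ k) ∷ []

iterSub : ℕ → Graph → Graph
iterSub zero    G = G
iterSub (suc n) G = subdivide (iterSub n G)

-- Σ over the edges incident to i of f(other endpoint) (loops counted twice)
nbrSum : (G : Graph) → Fin (N G) → (Fin (N G) → ℚ) → ℚ
nbrSum G i f = foldr (λ e acc → contrib e + acc) 0ℚ (edges G)
  where
  contrib : Fin (N G) × Fin (N G) → ℚ
  contrib (u , v) = (at u v) + (at v u)
    where
    at : Fin (N G) → Fin (N G) → ℚ
    at a b with a ≟ i
    ... | yes _ = f b
    ... | no  _ = 0ℚ

deg : (G : Graph) → Fin (N G) → ℚ
deg G i = nbrSum G i (λ _ → ℕ→ℚ 1)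

sumV : (G : Graph) → (Fin (N G) → ℚ) → ℚ
sumV G f = foldr (λ j acc → f j + acc) 0ℚ (allFin (N G))

-- h i j = expected hitting time of j for the simple random walk started at i,
-- characterised by the first-step equations:
--   h j j = 0,   d_i h i j = d_i + Σ_{k ~ i} h k j   (i ≠ j)
HittingTimes : (G : Graph) → (Fin (N G) → Fin (N G) → ℚ) → Set
HittingTimes G h =
  ∀ i j → (i ≡ j → h i j ≡ 0ℚ)
        × (i ≢ j → deg G i * h i j ≡ deg G i + nbrSum G i (λ k → h k j))

-- κ is the Kemeny constant of G:  for every start i,
--   κ = Σ_j π_j h i j ,  π_j = d_j / (2 E),  i.e.  2E κ = Σ_j d_j h i j
IsKemeny : Graph → ℚ → Set
IsKemeny G κ = Σ (Fin (N G) → Fin (N G) → ℚ) λ h →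
  HittingTimes G h × (∀ i → sumV G (λ j → deg G j * h i j) ≡ ℕ→ℚ (2 ℕ.* nEdges G) * κ)

circuitRank : Graph → ℚ
circuitRank G = Data.Rational._-_ (ℕ→ℚ (nEdges G)) (ℕ→ℚ (N G)) + ℕ→ℚ 1

{-# OPTIONS --safe #-}
-- Watched only at its original vertices, the walk on s(H) is the walk on H, and each of its steps
-- takes 4 steps of the walk on s(H) on average; so h′(u, v) = 4 h(u, v) between original vertices.
-- From the midpoint of an edge ab the walk first moves to a or b, and the hitting time of that
-- midpoint from x is 2 h(x, a) + 2 h(x, b) + γ, the constant γ being fixed by Kac's formula.
-- These candidates satisfy the first-step equations of s(H) by Kac's formula and Foster's
-- theorem on H; weighting them by the degrees of s(H) gives K(s H) = 4 K(H) + r - ½, because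
-- subdivision keeps the circuit rank r, and iterating the recurrence gives the closed form.
module Submission where

open import Defs
open import Data.Nat using (ℕ; suc; _≤_; _^_)
open import Data.Product using (_×_)
open import Data.Rational using (ℚ; _+_; _*_; _-_; ½; 1/_)

open import Algebra.Bundles using (CommutativeRing)
open import Data.Empty using (⊥-elim)
open import Data.Fin using (Fin; zero; suc; _↑ˡ_; _↑ʳ_; splitAt; join)
import Data.Fin as Fin
open import Data.Fin.Properties using (splitAt-↑ˡ; splitAt-↑ʳ; join-splitAt; ↑ˡ-injective)
import Data.Integer as ℤ
import Data.Integer.Properties as ℤ
open import Data.List using (List; []; _∷_; length; lookup; allFin; concatMap; foldr; tabulate)
open import Data.List.Properties using (foldr-cong; length-tabulate)
open import Data.Nat as ℕ using (zero)
import Data.Nat.Properties as ℕ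
open import Data.Product using (_,_; proj₁; proj₂)
open import Data.Rational using (0ℚ; 1ℚ; _/_)
open import Data.Rational.Literals using (fromℤ)
open import Data.Rational.Properties
  using (↥p/↧p≡p; +-*-commutativeRing; _≟_; +-assoc; +-comm; +-identityˡ; +-identityʳ;
         *-comm; *-identityˡ; *-identityʳ; *-zeroˡ; *-zeroʳ)
open import Algebra.Properties.Semiring.Sum (CommutativeRing.semiring +-*-commutativeRing)
  using (sum; sum-syntax; sum-cong-≗; ∑-distrib-+; ∑-comm; *-distribˡ-sum)
open import Data.Sum using (_⊎_; inj₁; inj₂; [_,_]′)
open import Function using (_∘_)
open import Relation.Binary.PropositionalEquality
open import Relation.Nullary using (yes; no)
open import Relation.Nullary.Decidable using (dec⇒maybe)
open import Tactic.RingSolver using (solve-∀)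
open import Tactic.RingSolver.Core.AlmostCommutativeRing using (AlmostCommutativeRing; fromCommutativeRing)

ℚ-ring : AlmostCommutativeRing _ _
ℚ-ring = fromCommutativeRing +-*-commutativeRing (λ x → dec⇒maybe (0ℚ ≟ x))

ℕ→ℚ-+ : ∀ m n → ℕ→ℚ (m ℕ.+ n) ≡ ℕ→ℚ m + ℕ→ℚ n
ℕ→ℚ-+ m n = begin
  ℕ→ℚ (m ℕ.+ n)                  ≡⟨ cong (_/ 1) (trans (ℤ.pos-+ m n) (sym +m*1+n*1)) ⟩
  fromℤ (ℤ.+ m) + fromℤ (ℤ.+ n)  ≡⟨ cong₂ _+_ (↥p/↧p≡p (fromℤ (ℤ.+ m))) (↥p/↧p≡p (fromℤ (ℤ.+ n))) ⟨
  ℕ→ℚ m + ℕ→ℚ n                  ∎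
  where
  open ≡-Reasoning
  +m*1+n*1 : ℤ.+ m ℤ.* ℤ.+ 1 ℤ.+ ℤ.+ n ℤ.* ℤ.+ 1 ≡ ℤ.+ m ℤ.+ ℤ.+ n
  +m*1+n*1 = cong₂ ℤ._+_ (ℤ.*-identityʳ (ℤ.+ m)) (ℤ.*-identityʳ (ℤ.+ n))

ℕ→ℚ-* : ∀ m n → ℕ→ℚ (m ℕ.* n) ≡ ℕ→ℚ m * ℕ→ℚ n
ℕ→ℚ-* m n = begin
  ℕ→ℚ (m ℕ.* n)                  ≡⟨ cong (_/ 1) (ℤ.pos-* m n) ⟩
  fromℤ (ℤ.+ m) * fromℤ (ℤ.+ n)  ≡⟨ cong₂ _*_ (↥p/↧p≡p (fromℤ (ℤ.+ m))) (↥p/↧p≡p (fromℤ (ℤ.+ n))) ⟨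
  ℕ→ℚ m * ℕ→ℚ n                  ∎
  where open ≡-Reasoning

t≡a+t-x⇒x≡a : ∀ {t a x} → t ≡ a + t - x → x ≡ a
t≡a+t-x⇒x≡a {t} {a} {x} eq = begin
  x                  ≡⟨ lemma₁ t a x ⟩
  a + t - (a + t - x) ≡⟨ cong (λ y → a + t - y) eq ⟨
  a + t - t          ≡⟨ lemma₂ t a ⟩
  a                  ∎
  where
  open ≡-Reasoning
  lemma₁ : ∀ t a x → x ≡ a + t - (a + t - x)
  lemma₁ = solve-∀ ℚ-ring
  lemma₂ : ∀ t a → a + t - t ≡ a
  lemma₂ = solve-∀ ℚ-ring

a+b≡c⇒b≡c-a : ∀ {a b c} → a + b ≡ c → b ≡ c - a
a+b≡c⇒b≡c-a {a} {b} eq = trans (lemma a b) (cong (_- a) eq)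
  where
  lemma : ∀ a b → b ≡ a + b - a
  lemma = solve-∀ ℚ-ring

δ : ∀ {n} → Fin n → Fin n → ℚ
δ zero    zero    = 1ℚ
δ zero    (suc _) = 0ℚ
δ (suc _) zero    = 0ℚ
δ (suc a) (suc b) = δ a b

δ-refl : ∀ {n} (a : Fin n) → δ a a ≡ 1ℚ
δ-refl zero    = refl
δ-refl (suc a) = δ-refl a

δ-≢ : ∀ {n} {a b : Fin n} → a ≢ b → δ a b ≡ 0ℚ
δ-≢ {a = zero}  {zero}  a≢b = ⊥-elim (a≢b refl)
δ-≢ {a = zero}  {suc b} a≢b = refl
δ-≢ {a = suc a} {zero}  a≢b = refl
δ-≢ {a = suc a} {suc b} a≢b = δ-≢ (a≢b ∘ cong suc)

δ-sym : ∀ {n} (a b : Fin n) → δ a b ≡ δ b a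
δ-sym zero    zero    = refl
δ-sym zero    (suc b) = refl
δ-sym (suc a) zero    = refl
δ-sym (suc a) (suc b) = δ-sym a b

δ-≡-* : ∀ {n} {a b : Fin n} x → a ≡ b → δ a b * x ≡ x
δ-≡-* {a = a} x refl = trans (cong (_* x) (δ-refl a)) (*-identityˡ x)

δ-≢-* : ∀ {n} {a b : Fin n} x → a ≢ b → δ a b * x ≡ 0ℚ
δ-≢-* x a≢b = trans (cong (_* x) (δ-≢ a≢b)) (*-zeroˡ x)

δ-↑ˡ : ∀ {n} m (a b : Fin n) → δ (a ↑ˡ m) (b ↑ˡ m) ≡ δ a b
δ-↑ˡ m zero    zero    = refl
δ-↑ˡ m zero    (suc b) = refl
δ-↑ˡ m (suc a) zero    = refl
δ-↑ˡ m (suc a) (suc b) = δ-↑ˡ m a b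

δ-↑ʳ : ∀ n {m} (a b : Fin m) → δ (n ↑ʳ a) (n ↑ʳ b) ≡ δ a b
δ-↑ʳ zero    a b = refl
δ-↑ʳ (suc n) a b = δ-↑ʳ n a b

δ-↑ˡ-↑ʳ : ∀ {n} m (a : Fin n) (b : Fin m) → δ (a ↑ˡ m) (n ↑ʳ b) ≡ 0ℚ
δ-↑ˡ-↑ʳ m zero    b = refl
δ-↑ˡ-↑ʳ m (suc a) b = δ-↑ˡ-↑ʳ m a b

δ-↑ʳ-↑ˡ : ∀ {n} m (a : Fin n) (b : Fin m) → δ (n ↑ʳ b) (a ↑ˡ m) ≡ 0ℚ
δ-↑ʳ-↑ˡ {n} m a b = trans (δ-sym (n ↑ʳ b) (a ↑ˡ m)) (δ-↑ˡ-↑ʳ m a b)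

δ-subst : ∀ {n} (a b : Fin n) (f : Fin n → ℚ) → δ a b * f a ≡ δ a b * f b
δ-subst a b f with a Fin.≟ b
... | yes refl = refl
... | no  a≢b  = trans (δ-≢-* (f a) a≢b) (sym (δ-≢-* (f b) a≢b))

∑-distrib-- : ∀ {n} (f g : Fin n → ℚ) → ∑[ k < n ] (f k - g k) ≡ ∑[ k < n ] f k - ∑[ k < n ] g k
∑-distrib-- {zero}  f g = refl
∑-distrib-- {suc n} f g = trans (cong (f zero - g zero +_) (∑-distrib-- (f ∘ suc) (g ∘ suc)))
                               (lemma (f zero) (g zero) (sum (f ∘ suc)) (sum (g ∘ suc)))
  where
  lemma : ∀ a b c d → a - b + (c - d) ≡ a + c - (b + d)
  lemma = solve-∀ ℚ-ring

∑-const : ∀ n c → ∑[ k < n ] c ≡ ℕ→ℚ n * c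
∑-const zero    c = sym (*-zeroˡ c)
∑-const (suc n) c = begin
  c + ∑[ k < n ] c       ≡⟨ cong (c +_) (∑-const n c) ⟩
  c + ℕ→ℚ n * c          ≡⟨ lemma c (ℕ→ℚ n) ⟩
  (1ℚ + ℕ→ℚ n) * c       ≡⟨ cong (_* c) (ℕ→ℚ-+ 1 n) ⟨
  ℕ→ℚ (suc n) * c        ∎
  where
  open ≡-Reasoning
  lemma : ∀ c m → c + m * c ≡ (1ℚ + m) * c
  lemma = solve-∀ ℚ-ring

∑-δˡ : ∀ {n} (a : Fin n) (f : Fin n → ℚ) → ∑[ j < n ] (δ a j * f j) ≡ f a
∑-δˡ {suc n} zero    f = begin
  1ℚ * f zero + ∑[ j < n ] (0ℚ * f (suc j)) ≡⟨ cong₂ _+_ (*-identityˡ (f zero)) (sum-cong-≗ (*-zeroˡ ∘ f ∘ suc)) ⟩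
  f zero + ∑[ j < n ] 0ℚ                    ≡⟨ cong (f zero +_) (trans (∑-const n 0ℚ) (*-zeroʳ (ℕ→ℚ n))) ⟩
  f zero + 0ℚ                               ≡⟨ +-identityʳ (f zero) ⟩
  f zero                                    ∎
  where open ≡-Reasoning
∑-δˡ {suc n} (suc a) f = trans (cong (_+ ∑[ j < n ] (δ a j * f (suc j))) (*-zeroˡ (f zero)))
                               (trans (+-identityˡ _) (∑-δˡ a (f ∘ suc)))

∑-δʳ : ∀ {n} (a : Fin n) (f : Fin n → ℚ) → ∑[ j < n ] (δ j a * f j) ≡ f a
∑-δʳ a f = trans (sum-cong-≗ (λ j → cong (_* f j) (δ-sym j a))) (∑-δˡ a f)

∑-↑ : ∀ n m (f : Fin (n ℕ.+ m) → ℚ) → sum f ≡ ∑[ u < n ] f (u ↑ˡ m) + ∑[ k < m ] f (n ↑ʳ k)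
∑-↑ zero    m f = sym (+-identityˡ (sum f))
∑-↑ (suc n) m f = trans (cong (f zero +_) (∑-↑ n m (f ∘ suc))) (sym (+-assoc (f zero) _ _))

foldr-tabulate-∑ : ∀ {A : Set} n (t : Fin n → A) (c : A → ℚ) →
                   foldr (λ x acc → c x + acc) 0ℚ (tabulate t) ≡ ∑[ k < n ] c (t k)
foldr-tabulate-∑ zero    t c = refl
foldr-tabulate-∑ (suc n) t c = cong (c (t zero) +_) (foldr-tabulate-∑ n (t ∘ suc) c)

foldr-lookup-∑ : ∀ {A : Set} (c : A → ℚ) (xs : List A) →
                 foldr (λ x acc → c x + acc) 0ℚ xs ≡ ∑[ k < length xs ] c (lookup xs k)
foldr-lookup-∑ c []       = refl
foldr-lookup-∑ c (x ∷ xs) = cong (c x +_) (foldr-lookup-∑ c xs)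

sumV-∑ : ∀ G f → sumV G f ≡ sum f
sumV-∑ G f = foldr-tabulate-∑ (N G) (λ j → j) f

incident : ∀ {n} → Fin n → (Fin n → ℚ) → Fin n × Fin n → ℚ
incident i f (u , v) = δ u i * f v + δ v i * f u

-- The step function of the fold defining nbrSum is local to Defs; unification recovers it.
private
  stepOf : ∀ {A : Set} {step : A → ℚ → ℚ} {xs : List A} →
           foldr step 0ℚ xs ≡ foldr step 0ℚ xs → A → ℚ → ℚ
  stepOf {step = step} _ = step

nbrStep : (G : Graph) → Fin (N G) → (Fin (N G) → ℚ) → Fin (N G) × Fin (N G) → ℚ → ℚ
nbrStep G i f = stepOf {xs = edges G} (refl {x = nbrSum G i f})

nbrStep-incident : ∀ G i f u v acc → nbrStep G i f (u , v) acc ≡ incident i f (u , v) + acc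
nbrStep-incident G i f u v acc with u Fin.≟ i | v Fin.≟ i
... | yes p | yes q = sym (cong₂ (λ x y → x + y + acc) (δ-≡-* (f v) p) (δ-≡-* (f u) q))
... | yes p | no  q = sym (cong₂ (λ x y → x + y + acc) (δ-≡-* (f v) p) (δ-≢-* (f u) q))
... | no  p | yes q = sym (cong₂ (λ x y → x + y + acc) (δ-≢-* (f v) p) (δ-≡-* (f u) q))
... | no  p | no  q = sym (cong₂ (λ x y → x + y + acc) (δ-≢-* (f v) p) (δ-≢-* (f u) q))

nbrSum-∑ : ∀ G i f → nbrSum G i f ≡ ∑[ k < nEdges G ] incident i f (lookup (edges G) k)
nbrSum-∑ G i f = trans (foldr-cong (λ { (u , v) → nbrStep-incident G i f u v }) refl (edges G))
                       (foldr-lookup-∑ (incident i f) (edges G))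

module EdgeList {n : ℕ} (es : List (Fin n × Fin n)) where

  E : ℕ
  E = length es

  end₁ end₂ : Fin E → Fin n
  end₁ k = proj₁ (lookup es k)
  end₂ k = proj₂ (lookup es k)

  vol : ℚ
  vol = ℕ→ℚ 2 * ℕ→ℚ E

  nbr : Fin n → (Fin n → ℚ) → ℚ
  nbr i f = ∑[ k < E ] (δ (end₁ k) i * f (end₂ k) + δ (end₂ k) i * f (end₁ k))

  d : Fin n → ℚ
  d i = nbr i (λ _ → 1ℚ)

  nbrSum≡nbr : ∀ i f → nbrSum (graph n es) i f ≡ nbr i f
  nbrSum≡nbr = nbrSum-∑ (graph n es)

  deg≡d : ∀ i → deg (graph n es) i ≡ d i
  deg≡d i = nbrSum≡nbr i (λ _ → 1ℚ)

  nbr-+ : ∀ i f g → nbr i (λ x → f x + g x) ≡ nbr i f + nbr i g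
  nbr-+ i f g = trans (sum-cong-≗ λ k → lemma (δ (end₁ k) i) (δ (end₂ k) i) (f (end₁ k)) (f (end₂ k)) (g (end₁ k)) (g (end₂ k)))
                      (∑-distrib-+ (incident i f ∘ lookup es) (incident i g ∘ lookup es))
    where
    lemma : ∀ p q a b a′ b′ → p * (b + b′) + q * (a + a′) ≡ (p * b + q * a) + (p * b′ + q * a′)
    lemma = solve-∀ ℚ-ring

  nbr-* : ∀ i c f → nbr i (λ x → c * f x) ≡ c * nbr i f
  nbr-* i c f = trans (sum-cong-≗ λ k → lemma (δ (end₁ k) i) (δ (end₂ k) i) (f (end₁ k)) (f (end₂ k)) c)
                      (sym (*-distribˡ-sum c (incident i f ∘ lookup es)))
    where
    lemma : ∀ p q a b c → p * (c * b) + q * (c * a) ≡ c * (p * b + q * a)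
    lemma = solve-∀ ℚ-ring

  nbr-const : ∀ i c → nbr i (λ _ → c) ≡ d i * c
  nbr-const i c = trans (sum-cong-≗ λ k → lemma (δ (end₁ k) i) (δ (end₂ k) i) c)
                        (trans (sym (*-distribˡ-sum c (incident i (λ _ → 1ℚ) ∘ lookup es))) (*-comm c (d i)))
    where
    lemma : ∀ p q c → p * c + q * c ≡ c * (p * 1ℚ + q * 1ℚ)
    lemma = solve-∀ ℚ-ring

  nbr-affine : ∀ i c s f → nbr i (λ x → c + s * f x) ≡ d i * c + s * nbr i f
  nbr-affine i c s f = trans (nbr-+ i (λ _ → c) (λ x → s * f x)) (cong₂ _+_ (nbr-const i c) (nbr-* i s f))

  ∑-nbr : ∀ (F : Fin n → Fin n → ℚ) →
          ∑[ j < n ] nbr j (F j) ≡ ∑[ k < E ] (F (end₁ k) (end₂ k) + F (end₂ k) (end₁ k))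
  ∑-nbr F = begin
    ∑[ j < n ] nbr j (F j)
      ≡⟨ ∑-comm (λ j k → incident j (F j) (lookup es k)) ⟩
    ∑[ k < E ] ∑[ j < n ] (δ (end₁ k) j * F j (end₂ k) + δ (end₂ k) j * F j (end₁ k))
      ≡⟨ sum-cong-≗ (λ k → ∑-distrib-+ (λ j → δ (end₁ k) j * F j (end₂ k)) (λ j → δ (end₂ k) j * F j (end₁ k))) ⟩
    ∑[ k < E ] (∑[ j < n ] (δ (end₁ k) j * F j (end₂ k)) + ∑[ j < n ] (δ (end₂ k) j * F j (end₁ k)))
      ≡⟨ sum-cong-≗ (λ k → cong₂ _+_ (∑-δˡ (end₁ k) (λ j → F j (end₂ k))) (∑-δˡ (end₂ k) (λ j → F j (end₁ k)))) ⟩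
    ∑[ k < E ] (F (end₁ k) (end₂ k) + F (end₂ k) (end₁ k))
      ∎
    where open ≡-Reasoning

  ∑-d* : ∀ (g : Fin n → ℚ) → ∑[ j < n ] (d j * g j) ≡ ∑[ k < E ] (g (end₁ k) + g (end₂ k))
  ∑-d* g = trans (sum-cong-≗ λ j → sym (nbr-const j (g j))) (∑-nbr (λ j _ → g j))

  ∑-d : sum d ≡ vol
  ∑-d = begin
    sum d                      ≡⟨ sum-cong-≗ (λ j → *-identityʳ (d j)) ⟨
    ∑[ j < n ] (d j * 1ℚ)      ≡⟨ ∑-d* (λ _ → 1ℚ) ⟩
    ∑[ k < E ] ℕ→ℚ 2           ≡⟨ ∑-const E (ℕ→ℚ 2) ⟩
    ℕ→ℚ E * ℕ→ℚ 2              ≡⟨ *-comm (ℕ→ℚ E) (ℕ→ℚ 2) ⟩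
    vol                        ∎
    where open ≡-Reasoning

  module HittingTimeIdentities {h : Fin n → Fin n → ℚ} (ht : HittingTimes (graph n es) h) where

    h-diag : ∀ i → h i i ≡ 0ℚ
    h-diag i = proj₁ (ht i i) refl

    h-step : ∀ i j → i ≢ j → d i * h i j ≡ d i + nbr i (λ x → h x j)
    h-step i j i≢j = begin
      d i * h i j                                  ≡⟨ cong (_* h i j) (deg≡d i) ⟨
      deg (graph n es) i * h i j                   ≡⟨ proj₂ (ht i j) i≢j ⟩
      deg (graph n es) i + nbrSum (graph n es) i _ ≡⟨ cong₂ _+_ (deg≡d i) (nbrSum≡nbr i (λ x → h x j)) ⟩
      d i + nbr i (λ x → h x j)                    ∎
      where open ≡-Reasoning

    h-step-δ : ∀ i j → d i * h i j ≡ (1ℚ - δ i j) * (d i + nbr i (λ x → h x j))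
    h-step-δ i j with i Fin.≟ j
    ... | yes refl rewrite h-diag i | δ-refl i = lemma (d i) (nbr i (λ x → h x i))
      where
      lemma : ∀ a b → a * 0ℚ ≡ (1ℚ - 1ℚ) * (a + b)
      lemma = solve-∀ ℚ-ring
    ... | no  i≢j rewrite δ-≢ i≢j = trans (h-step i j i≢j) (lemma (d i + nbr i (λ x → h x j)))
      where
      lemma : ∀ a → a ≡ (1ℚ - 0ℚ) * a
      lemma = solve-∀ ℚ-ring

    ∑-nbr-h : ∀ j → ∑[ i < n ] nbr i (λ x → h x j) ≡ ∑[ i < n ] (d i * h i j)
    ∑-nbr-h j = begin
      ∑[ i < n ] nbr i (λ x → h x j)                   ≡⟨ ∑-nbr (λ _ x → h x j) ⟩
      ∑[ k < E ] (h (end₂ k) j + h (end₁ k) j)         ≡⟨ sum-cong-≗ (λ k → +-comm (h (end₂ k) j) (h (end₁ k) j)) ⟩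
      ∑[ k < E ] (h (end₁ k) j + h (end₂ k) j)         ≡⟨ ∑-d* (λ x → h x j) ⟨
      ∑[ i < n ] (d i * h i j)                         ∎
      where open ≡-Reasoning

    -- Kac's formula: the mean return time to j is vol / d j.
    kac : ∀ j → d j + nbr j (λ x → h x j) ≡ vol
    kac j = t≡a+t-x⇒x≡a (begin
      T                                       ≡⟨ sum-cong-≗ (λ i → h-step-δ i j) ⟩
      ∑[ i < n ] ((1ℚ - δ i j) * X i)         ≡⟨ sum-cong-≗ (λ i → lemma (δ i j) (X i)) ⟩
      ∑[ i < n ] (X i - δ i j * X i)          ≡⟨ ∑-distrib-- X (λ i → δ i j * X i) ⟩
      sum X - ∑[ i < n ] (δ i j * X i)        ≡⟨ cong₂ _-_ (∑-distrib-+ d (λ i → nbr i (λ x → h x j))) (∑-δʳ j X) ⟩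
      sum d + ∑[ i < n ] nbr i (λ x → h x j) - X j ≡⟨ cong₂ (λ a b → a + b - X j) ∑-d (∑-nbr-h j) ⟩
      vol + T - X j                           ∎)
      where
      open ≡-Reasoning
      X : Fin n → ℚ
      X i = d i + nbr i (λ x → h x j)
      T : ℚ
      T = ∑[ i < n ] (d i * h i j)
      lemma : ∀ p x → (1ℚ - p) * x ≡ x - p * x
      lemma = solve-∀ ℚ-ring

    nbr-h : ∀ u v → nbr u (λ x → h x v) ≡ d u * h u v - d u + δ u v * vol
    nbr-h u v with u Fin.≟ v
    ... | yes refl rewrite h-diag u | δ-refl u = trans (a+b≡c⇒b≡c-a (kac u)) (lemma (d u) vol)
      where
      lemma : ∀ a v → v - a ≡ a * 0ℚ - a + 1ℚ * v
      lemma = solve-∀ ℚ-ring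
    ... | no  u≢v rewrite δ-≢ u≢v = trans (a+b≡c⇒b≡c-a (sym (h-step u v u≢v))) (lemma (d u * h u v) (d u) vol)
      where
      lemma : ∀ c a v → c - a ≡ c - a + 0ℚ * v
      lemma = solve-∀ ℚ-ring

    foster : ∑[ k < E ] (h (end₁ k) (end₂ k) + h (end₂ k) (end₁ k)) ≡ ℕ→ℚ n * vol - vol
    foster = begin
      ∑[ k < E ] (h (end₁ k) (end₂ k) + h (end₂ k) (end₁ k))
        ≡⟨ sum-cong-≗ (λ k → +-comm (h (end₁ k) (end₂ k)) (h (end₂ k) (end₁ k))) ⟩
      ∑[ k < E ] (h (end₂ k) (end₁ k) + h (end₁ k) (end₂ k))
        ≡⟨ ∑-nbr (λ j x → h x j) ⟨
      ∑[ j < n ] nbr j (λ x → h x j)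
        ≡⟨ sum-cong-≗ (λ j → a+b≡c⇒b≡c-a (kac j)) ⟩
      ∑[ j < n ] (vol - d j)
        ≡⟨ ∑-distrib-- (λ _ → vol) d ⟩
      ∑[ j < n ] vol - sum d
        ≡⟨ cong₂ _-_ (∑-const n vol) ∑-d ⟩
      ℕ→ℚ n * vol - vol
        ∎
      where open ≡-Reasoning

length-concatMap-pairs : ∀ {A B : Set} (p q : A → B) (xs : List A) →
                         length (concatMap (λ x → p x ∷ q x ∷ []) xs) ≡ 2 ℕ.* length xs
length-concatMap-pairs p q []       = refl
length-concatMap-pairs p q (x ∷ xs) =
  trans (cong (2 ℕ.+_) (length-concatMap-pairs p q xs)) (sym (ℕ.*-suc 2 (length xs)))

foldr-concatMap-pairs-∑ : ∀ {A B : Set} m (t : Fin m → A) (p q : A → B) (c : B → ℚ) →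
  foldr (λ e acc → c e + acc) 0ℚ (concatMap (λ x → p x ∷ q x ∷ []) (tabulate t))
    ≡ ∑[ k < m ] (c (p (t k)) + c (q (t k)))
foldr-concatMap-pairs-∑ zero    t p q c = refl
foldr-concatMap-pairs-∑ (suc m) t p q c =
  trans (cong (λ y → c (p (t zero)) + (c (q (t zero)) + y)) (foldr-concatMap-pairs-∑ m (t ∘ suc) p q c))
        (sym (+-assoc (c (p (t zero))) (c (q (t zero))) _))

module Subdivision {n : ℕ} (es : List (Fin n × Fin n)) where
  open EdgeList es

  sH : Graph
  sH = subdivide (graph n es)

  org : Fin n → Fin (n ℕ.+ E)
  org u = u ↑ˡ E

  mid : Fin E → Fin (n ℕ.+ E)
  mid k = n ↑ʳ k

  vertex-rec : {X : Set} → (Fin n → X) → (Fin E → X) → Fin (n ℕ.+ E) → X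
  vertex-rec f g z = [ f , g ]′ (splitAt n z)

  vertex-rec-org : ∀ {X : Set} (f : Fin n → X) (g : Fin E → X) u → vertex-rec f g (org u) ≡ f u
  vertex-rec-org f g u = cong [ f , g ]′ (splitAt-↑ˡ n u E)

  vertex-rec-mid : ∀ {X : Set} (f : Fin n → X) (g : Fin E → X) k → vertex-rec f g (mid k) ≡ g k
  vertex-rec-mid f g k = cong [ f , g ]′ (splitAt-↑ʳ n E k)

  vertex-ind : (P : Fin (n ℕ.+ E) → Set) → (∀ u → P (org u)) → (∀ k → P (mid k)) → ∀ z → P z
  vertex-ind P P-org P-mid z = subst P (join-splitAt n E z) (by-cases (splitAt n z))
    where
    by-cases : (s : Fin n ⊎ Fin E) → P (join n E s)
    by-cases (inj₁ u) = P-org u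
    by-cases (inj₂ k) = P-mid k

  half₁ half₂ : Fin E → Fin (n ℕ.+ E) × Fin (n ℕ.+ E)
  half₁ k = org (end₁ k) , mid k
  half₂ k = org (end₂ k) , mid k

  nEdges-sH : nEdges sH ≡ 2 ℕ.* E
  nEdges-sH = trans (length-concatMap-pairs half₁ half₂ (allFin E)) (cong (2 ℕ.*_) (length-tabulate {n = E} (λ k → k)))

  nbrSum-sH : ∀ z g → nbrSum sH z g ≡ ∑[ k < E ] (incident z g (half₁ k) + incident z g (half₂ k))
  nbrSum-sH z g = trans (foldr-cong (λ { (u , v) → nbrStep-incident sH z g u v }) refl (edges sH))
                        (foldr-concatMap-pairs-∑ E (λ k → k) half₁ half₂ (incident z g))

  incidence : Fin n → Fin E → ℚ
  incidence u k = δ (end₁ k) u + δ (end₂ k) u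

  nbrSum-org : ∀ u g → nbrSum sH (org u) g ≡ ∑[ k < E ] (incidence u k * g (mid k))
  nbrSum-org u g = trans (nbrSum-sH (org u) g) (sum-cong-≗ pointwise)
    where
    lemma : ∀ p q x y z → p * x + 0ℚ * y + (q * x + 0ℚ * z) ≡ (p + q) * x
    lemma = solve-∀ ℚ-ring
    pointwise : ∀ k → incident (org u) g (half₁ k) + incident (org u) g (half₂ k) ≡ incidence u k * g (mid k)
    pointwise k rewrite δ-↑ˡ E (end₁ k) u | δ-↑ˡ E (end₂ k) u | δ-↑ʳ-↑ˡ E u k =
      lemma (δ (end₁ k) u) (δ (end₂ k) u) (g (mid k)) (g (org (end₁ k))) (g (org (end₂ k)))

  nbrSum-mid : ∀ j g → nbrSum sH (mid j) g ≡ g (org (end₁ j)) + g (org (end₂ j))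
  nbrSum-mid j g = begin
    nbrSum sH (mid j) g                                     ≡⟨ nbrSum-sH (mid j) g ⟩
    ∑[ k < E ] (incident (mid j) g (half₁ k) + incident (mid j) g (half₂ k))
                                                            ≡⟨ sum-cong-≗ pointwise ⟩
    ∑[ k < E ] (δ k j * (g (org (end₁ k)) + g (org (end₂ k)))) ≡⟨ ∑-δʳ j (λ k → g (org (end₁ k)) + g (org (end₂ k))) ⟩
    g (org (end₁ j)) + g (org (end₂ j))                     ∎
    where
    open ≡-Reasoning
    lemma : ∀ p x y z w → 0ℚ * x + p * y + (0ℚ * z + p * w) ≡ p * (y + w)
    lemma = solve-∀ ℚ-ring
    pointwise : ∀ k → incident (mid j) g (half₁ k) + incident (mid j) g (half₂ k)
                      ≡ δ k j * (g (org (end₁ k)) + g (org (end₂ k)))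
    pointwise k rewrite δ-↑ˡ-↑ʳ E (end₁ k) j | δ-↑ˡ-↑ʳ E (end₂ k) j | δ-↑ʳ n k j =
      lemma (δ k j) (g (mid k)) (g (org (end₁ k))) (g (mid k)) (g (org (end₂ k)))

  deg-org : ∀ u → deg sH (org u) ≡ d u
  deg-org u = trans (nbrSum-org u (λ _ → 1ℚ)) (sum-cong-≗ λ k → lemma (δ (end₁ k) u) (δ (end₂ k) u))
    where
    lemma : ∀ p q → (p + q) * 1ℚ ≡ p * 1ℚ + q * 1ℚ
    lemma = solve-∀ ℚ-ring

  deg-mid : ∀ j → deg sH (mid j) ≡ ℕ→ℚ 2
  deg-mid j = nbrSum-mid j (λ _ → 1ℚ)

  ∑-deg-sH : sum (deg sH) ≡ vol + vol
  ∑-deg-sH = begin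
    sum (deg sH)                                       ≡⟨ ∑-↑ n E (deg sH) ⟩
    ∑[ u < n ] deg sH (org u) + ∑[ k < E ] deg sH (mid k) ≡⟨ cong₂ _+_ (sum-cong-≗ deg-org) (sum-cong-≗ deg-mid) ⟩
    sum d + ∑[ k < E ] ℕ→ℚ 2                           ≡⟨ cong₂ _+_ ∑-d (∑-const E (ℕ→ℚ 2)) ⟩
    vol + ℕ→ℚ E * ℕ→ℚ 2                                ≡⟨ cong (vol +_) (*-comm (ℕ→ℚ E) (ℕ→ℚ 2)) ⟩
    vol + vol                                          ∎
    where open ≡-Reasoning

  ∑-incidence : ∀ u (f : Fin n → ℚ) → ∑[ k < E ] (incidence u k * (f (end₁ k) + f (end₂ k))) ≡ d u * f u + nbr u f
  ∑-incidence u f = begin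
    ∑[ k < E ] (incidence u k * (f (end₁ k) + f (end₂ k)))
      ≡⟨ sum-cong-≗ pointwise ⟩
    ∑[ k < E ] (f u * (δ (end₁ k) u * 1ℚ + δ (end₂ k) u * 1ℚ) + (δ (end₁ k) u * f (end₂ k) + δ (end₂ k) u * f (end₁ k)))
      ≡⟨ ∑-distrib-+ (λ k → f u * incident u (λ _ → 1ℚ) (lookup es k)) (incident u f ∘ lookup es) ⟩
    ∑[ k < E ] (f u * (δ (end₁ k) u * 1ℚ + δ (end₂ k) u * 1ℚ)) + nbr u f
      ≡⟨ cong (_+ nbr u f) (sym (*-distribˡ-sum (f u) (incident u (λ _ → 1ℚ) ∘ lookup es))) ⟩
    f u * d u + nbr u f
      ≡⟨ cong (_+ nbr u f) (*-comm (f u) (d u)) ⟩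
    d u * f u + nbr u f
      ∎
    where
    open ≡-Reasoning
    expand : ∀ p q x y → (p + q) * (x + y) ≡ p * x + q * y + (p * y + q * x)
    expand = solve-∀ ℚ-ring
    collect : ∀ p q z r → p * z + q * z + r ≡ z * (p * 1ℚ + q * 1ℚ) + r
    collect = solve-∀ ℚ-ring
    pointwise : ∀ k → incidence u k * (f (end₁ k) + f (end₂ k))
                      ≡ f u * (δ (end₁ k) u * 1ℚ + δ (end₂ k) u * 1ℚ) + (δ (end₁ k) u * f (end₂ k) + δ (end₂ k) u * f (end₁ k))
    pointwise k = begin
      (p + q) * (f a + f b)                   ≡⟨ expand p q (f a) (f b) ⟩
      p * f a + q * f b + (p * f b + q * f a) ≡⟨ cong₂ (λ x y → x + y + (p * f b + q * f a)) (δ-subst a u f) (δ-subst b u f) ⟩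
      p * f u + q * f u + (p * f b + q * f a) ≡⟨ collect p q (f u) (p * f b + q * f a) ⟩
      f u * (p * 1ℚ + q * 1ℚ) + (p * f b + q * f a) ∎
      where
      a b : Fin n
      a = end₁ k
      b = end₂ k
      p q : ℚ
      p = δ a u
      q = δ b u

  module HittingTimesOnSubdivision {h : Fin n → Fin n → ℚ} (ht : HittingTimes (graph n es) h) where
    open HittingTimeIdentities ht

    -- Forced by Kac's formula at mid j: the walk on sH returns there after vol steps on average.
    γ : Fin E → ℚ
    γ j = vol - 1ℚ - h (end₁ j) (end₂ j) - h (end₂ j) (end₁ j)

    to-mid : Fin n → Fin E → ℚ
    to-mid x j = ℕ→ℚ 2 * h x (end₁ j) + ℕ→ℚ 2 * h x (end₂ j) + γ j

    from-org : Fin n → Fin (n ℕ.+ E) → ℚ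
    from-org x = vertex-rec (λ v → ℕ→ℚ 4 * h x v) (to-mid x)

    from-mid : Fin E → Fin (n ℕ.+ E) → ℚ
    from-mid k t = 1ℚ + ½ * (from-org (end₁ k) t + from-org (end₂ k) t)

    h′ : Fin (n ℕ.+ E) → Fin (n ℕ.+ E) → ℚ
    h′ z t = vertex-rec (λ x → from-org x t) (λ k → (1ℚ - δ (mid k) t) * from-mid k t) z

    h′-org : ∀ u t → h′ (org u) t ≡ from-org u t
    h′-org u t = vertex-rec-org (λ x → from-org x t) (λ k → (1ℚ - δ (mid k) t) * from-mid k t) u

    h′-mid : ∀ k t → h′ (mid k) t ≡ (1ℚ - δ (mid k) t) * from-mid k t
    h′-mid k t = vertex-rec-mid (λ x → from-org x t) (λ k → (1ℚ - δ (mid k) t) * from-mid k t) k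

    from-org-org : ∀ x v → from-org x (org v) ≡ ℕ→ℚ 4 * h x v
    from-org-org x v = vertex-rec-org (λ v → ℕ→ℚ 4 * h x v) (to-mid x) v

    from-org-mid : ∀ x j → from-org x (mid j) ≡ to-mid x j
    from-org-mid x j = vertex-rec-mid (λ v → ℕ→ℚ 4 * h x v) (to-mid x) j

    h′-org-org : ∀ u v → h′ (org u) (org v) ≡ ℕ→ℚ 4 * h u v
    h′-org-org u v = trans (h′-org u (org v)) (from-org-org u v)

    h′-org-mid : ∀ u j → h′ (org u) (mid j) ≡ to-mid u j
    h′-org-mid u j = trans (h′-org u (mid j)) (from-org-mid u j)

    from-mid-return : ∀ j → from-mid j (mid j) ≡ vol
    from-mid-return j = begin
      1ℚ + ½ * (from-org a (mid j) + from-org b (mid j))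
        ≡⟨ cong (λ y → 1ℚ + ½ * y) (cong₂ _+_ (from-org-mid a j) (from-org-mid b j)) ⟩
      1ℚ + ½ * (to-mid a j + to-mid b j)
        ≡⟨ cong₂ (λ x y → 1ℚ + ½ * ((ℕ→ℚ 2 * x + ℕ→ℚ 2 * h a b + γ j) + (ℕ→ℚ 2 * h b a + ℕ→ℚ 2 * y + γ j))) (h-diag a) (h-diag b) ⟩
      1ℚ + ½ * ((ℕ→ℚ 2 * 0ℚ + ℕ→ℚ 2 * h a b + γ j) + (ℕ→ℚ 2 * h b a + ℕ→ℚ 2 * 0ℚ + γ j))
        ≡⟨ lemma vol (h a b) (h b a) ⟩
      vol ∎
      where
      open ≡-Reasoning
      a b : Fin n
      a = end₁ j
      b = end₂ j
      lemma : ∀ v p q → 1ℚ + ½ * ((ℕ→ℚ 2 * 0ℚ + ℕ→ℚ 2 * p + (v - 1ℚ - p - q)) + (ℕ→ℚ 2 * q + ℕ→ℚ 2 * 0ℚ + (v - 1ℚ - p - q))) ≡ v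
      lemma = solve-∀ ℚ-ring

    from-mid-org : ∀ k v → from-mid k (org v) ≡ (½ + ℕ→ℚ 2 * h (end₁ k) v) + (½ + ℕ→ℚ 2 * h (end₂ k) v)
    from-mid-org k v = trans (cong (λ y → 1ℚ + ½ * y) (cong₂ _+_ (from-org-org (end₁ k) v) (from-org-org (end₂ k) v)))
                             (lemma (h (end₁ k) v) (h (end₂ k) v))
      where
      lemma : ∀ x y → 1ℚ + ½ * (ℕ→ℚ 4 * x + ℕ→ℚ 4 * y) ≡ (½ + ℕ→ℚ 2 * x) + (½ + ℕ→ℚ 2 * y)
      lemma = solve-∀ ℚ-ring

    from-mid-mid : ∀ k j → from-mid k (mid j) ≡ (½ + ½ * to-mid (end₁ k) j) + (½ + ½ * to-mid (end₂ k) j)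
    from-mid-mid k j = trans (cong (λ y → 1ℚ + ½ * y) (cong₂ _+_ (from-org-mid (end₁ k) j) (from-org-mid (end₂ k) j)))
                             (lemma (to-mid (end₁ k) j) (to-mid (end₂ k) j))
      where
      lemma : ∀ x y → 1ℚ + ½ * (x + y) ≡ (½ + ½ * x) + (½ + ½ * y)
      lemma = solve-∀ ℚ-ring

    nbr-to-mid : ∀ u j → nbr u (λ x → to-mid x j)
                         ≡ ℕ→ℚ 2 * nbr u (λ x → h x (end₁ j)) + ℕ→ℚ 2 * nbr u (λ x → h x (end₂ j)) + d u * γ j
    nbr-to-mid u j = begin
      nbr u (λ x → ℕ→ℚ 2 * h x a + ℕ→ℚ 2 * h x b + γ j)
        ≡⟨ nbr-+ u (λ x → ℕ→ℚ 2 * h x a + ℕ→ℚ 2 * h x b) (λ _ → γ j) ⟩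
      nbr u (λ x → ℕ→ℚ 2 * h x a + ℕ→ℚ 2 * h x b) + nbr u (λ _ → γ j)
        ≡⟨ cong₂ _+_ (nbr-+ u (λ x → ℕ→ℚ 2 * h x a) (λ x → ℕ→ℚ 2 * h x b)) (nbr-const u (γ j)) ⟩
      nbr u (λ x → ℕ→ℚ 2 * h x a) + nbr u (λ x → ℕ→ℚ 2 * h x b) + d u * γ j
        ≡⟨ cong (_+ d u * γ j) (cong₂ _+_ (nbr-* u (ℕ→ℚ 2) (λ x → h x a)) (nbr-* u (ℕ→ℚ 2) (λ x → h x b))) ⟩
      ℕ→ℚ 2 * nbr u (λ x → h x a) + ℕ→ℚ 2 * nbr u (λ x → h x b) + d u * γ j
        ∎
      where
      open ≡-Reasoning
      a b : Fin n
      a = end₁ j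
      b = end₂ j

    FirstStepAt : Fin (n ℕ.+ E) → Fin (n ℕ.+ E) → Set
    FirstStepAt z t = (z ≡ t → h′ z t ≡ 0ℚ)
                    × (z ≢ t → deg sH z * h′ z t ≡ deg sH z + nbrSum sH z (λ x → h′ x t))

    first-step-mid : ∀ k t → FirstStepAt (mid k) t
    first-step-mid k t = at-target , step
      where
      open ≡-Reasoning
      at-target : mid k ≡ t → h′ (mid k) t ≡ 0ℚ
      at-target refl = begin
        h′ (mid k) (mid k)                       ≡⟨ h′-mid k (mid k) ⟩
        (1ℚ - δ (mid k) (mid k)) * from-mid k (mid k) ≡⟨ cong (λ p → (1ℚ - p) * from-mid k (mid k)) (δ-refl (mid k)) ⟩
        (1ℚ - 1ℚ) * from-mid k (mid k)           ≡⟨ *-zeroˡ (from-mid k (mid k)) ⟩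
        0ℚ                                       ∎
      lemma : ∀ x y → ℕ→ℚ 2 * ((1ℚ - 0ℚ) * (1ℚ + ½ * (x + y))) ≡ ℕ→ℚ 2 + (x + y)
      lemma = solve-∀ ℚ-ring
      step : mid k ≢ t → deg sH (mid k) * h′ (mid k) t ≡ deg sH (mid k) + nbrSum sH (mid k) (λ x → h′ x t)
      step mid-k≢t = begin
        deg sH (mid k) * h′ (mid k) t
          ≡⟨ cong₂ _*_ (deg-mid k) (trans (h′-mid k t) (cong (λ p → (1ℚ - p) * from-mid k t) (δ-≢ mid-k≢t))) ⟩
        ℕ→ℚ 2 * ((1ℚ - 0ℚ) * from-mid k t)
          ≡⟨ lemma (from-org (end₁ k) t) (from-org (end₂ k) t) ⟩
        ℕ→ℚ 2 + (from-org (end₁ k) t + from-org (end₂ k) t)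
          ≡⟨ cong₂ _+_ (deg-mid k) (trans (nbrSum-mid k _) (cong₂ _+_ (h′-org (end₁ k) t) (h′-org (end₂ k) t))) ⟨
        deg sH (mid k) + nbrSum sH (mid k) (λ x → h′ x t)
          ∎

    first-step-org-org : ∀ u v → FirstStepAt (org u) (org v)
    first-step-org-org u v = at-target , step
      where
      open ≡-Reasoning
      at-target : org u ≡ org v → h′ (org u) (org v) ≡ 0ℚ
      at-target eq = begin
        h′ (org u) (org v) ≡⟨ h′-org-org u v ⟩
        ℕ→ℚ 4 * h u v      ≡⟨ cong (λ w → ℕ→ℚ 4 * h u w) (↑ˡ-injective E u v eq) ⟨
        ℕ→ℚ 4 * h u u      ≡⟨ cong (ℕ→ℚ 4 *_) (h-diag u) ⟩
        ℕ→ℚ 4 * 0ℚ         ≡⟨ *-zeroʳ (ℕ→ℚ 4) ⟩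
        0ℚ                 ∎
      F : Fin n → ℚ
      F x = ½ + ℕ→ℚ 2 * h x v
      mid-to-org : ∀ k → h′ (mid k) (org v) ≡ F (end₁ k) + F (end₂ k)
      mid-to-org k = begin
        h′ (mid k) (org v)                         ≡⟨ h′-mid k (org v) ⟩
        (1ℚ - δ (mid k) (org v)) * from-mid k (org v) ≡⟨ cong (λ p → (1ℚ - p) * from-mid k (org v)) (δ-↑ʳ-↑ˡ E v k) ⟩
        (1ℚ - 0ℚ) * from-mid k (org v)             ≡⟨ *-identityˡ (from-mid k (org v)) ⟩
        from-mid k (org v)                         ≡⟨ from-mid-org k v ⟩
        F (end₁ k) + F (end₂ k)                    ∎
      lemma : ∀ c x w → c + (c * (½ + ℕ→ℚ 2 * x) + (c * ½ + ℕ→ℚ 2 * (c * x - c + 0ℚ * w))) ≡ c * (ℕ→ℚ 4 * x)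
      lemma = solve-∀ ℚ-ring
      step : org u ≢ org v → deg sH (org u) * h′ (org u) (org v) ≡ deg sH (org u) + nbrSum sH (org u) (λ x → h′ x (org v))
      step org-u≢org-v = sym (begin
        deg sH (org u) + nbrSum sH (org u) (λ x → h′ x (org v))
          ≡⟨ cong₂ _+_ (deg-org u) (nbrSum-org u (λ x → h′ x (org v))) ⟩
        d u + ∑[ k < E ] (incidence u k * h′ (mid k) (org v))
          ≡⟨ cong (d u +_) (sum-cong-≗ λ k → cong (incidence u k *_) (mid-to-org k)) ⟩
        d u + ∑[ k < E ] (incidence u k * (F (end₁ k) + F (end₂ k)))
          ≡⟨ cong (d u +_) (∑-incidence u F) ⟩
        d u + (d u * F u + nbr u F)
          ≡⟨ cong (λ y → d u + (d u * F u + y)) (nbr-affine u ½ (ℕ→ℚ 2) (λ x → h x v)) ⟩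
        d u + (d u * F u + (d u * ½ + ℕ→ℚ 2 * nbr u (λ x → h x v)))
          ≡⟨ cong (λ y → d u + (d u * F u + (d u * ½ + ℕ→ℚ 2 * y))) (nbr-h u v) ⟩
        d u + (d u * F u + (d u * ½ + ℕ→ℚ 2 * (d u * h u v - d u + δ u v * vol)))
          ≡⟨ cong (λ p → d u + (d u * F u + (d u * ½ + ℕ→ℚ 2 * (d u * h u v - d u + p * vol)))) (δ-≢ (org-u≢org-v ∘ cong org)) ⟩
        d u + (d u * F u + (d u * ½ + ℕ→ℚ 2 * (d u * h u v - d u + 0ℚ * vol)))
          ≡⟨ lemma (d u) (h u v) vol ⟩
        d u * (ℕ→ℚ 4 * h u v)
          ≡⟨ cong₂ _*_ (deg-org u) (h′-org-org u v) ⟨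
        deg sH (org u) * h′ (org u) (org v)
          ∎)

    first-step-org-mid : ∀ u j → FirstStepAt (org u) (mid j)
    first-step-org-mid u j = at-target , step
      where
      open ≡-Reasoning
      a b : Fin n
      a = end₁ j
      b = end₂ j
      at-target : org u ≡ mid j → h′ (org u) (mid j) ≡ 0ℚ
      at-target eq with () ← trans (sym (δ-↑ˡ-↑ʳ E u j)) (trans (cong (λ z → δ z (mid j)) eq) (δ-refl (mid j)))
      F : Fin n → ℚ
      F x = ½ + ½ * to-mid x j
      M : Fin E → ℚ
      M k = incidence u k * from-mid k (mid j)
      via-mid : ∀ k → incidence u k * h′ (mid k) (mid j) ≡ M k - δ k j * M k
      via-mid k = trans (cong (incidence u k *_) (trans (h′-mid k (mid j)) (cong (λ p → (1ℚ - p) * from-mid k (mid j)) (δ-↑ʳ n k j))))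
                        (lemma (incidence u k) (δ k j) (from-mid k (mid j)))
        where
        lemma : ∀ c p m → c * ((1ℚ - p) * m) ≡ c * m - p * (c * m)
        lemma = solve-∀ ℚ-ring
      ∑-incidence-h′ : ∑[ k < E ] (incidence u k * h′ (mid k) (mid j)) ≡ d u * F u + nbr u F - (δ u a + δ u b) * vol
      ∑-incidence-h′ = begin
        ∑[ k < E ] (incidence u k * h′ (mid k) (mid j))
          ≡⟨ trans (sum-cong-≗ via-mid) (∑-distrib-- M (λ k → δ k j * M k)) ⟩
        sum M - ∑[ k < E ] (δ k j * M k)
          ≡⟨ cong₂ _-_ (sum-cong-≗ λ k → cong (incidence u k *_) (from-mid-mid k j)) (∑-δʳ j M) ⟩
        ∑[ k < E ] (incidence u k * (F (end₁ k) + F (end₂ k))) - incidence u j * from-mid j (mid j)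
          ≡⟨ cong₂ _-_ (∑-incidence u F) (cong₂ _*_ (cong₂ _+_ (δ-sym a u) (δ-sym b u)) (from-mid-return j)) ⟩
        d u * F u + nbr u F - (δ u a + δ u b) * vol
          ∎
      nbr-h-a nbr-h-b : ℚ
      nbr-h-a = d u * h u a - d u + δ u a * vol
      nbr-h-b = d u * h u b - d u + δ u b * vol
      nbr-F : nbr u F ≡ d u * ½ + ½ * (ℕ→ℚ 2 * nbr-h-a + ℕ→ℚ 2 * nbr-h-b + d u * γ j)
      nbr-F = begin
        nbr u F
          ≡⟨ nbr-affine u ½ ½ (λ x → to-mid x j) ⟩
        d u * ½ + ½ * nbr u (λ x → to-mid x j)
          ≡⟨ cong (λ y → d u * ½ + ½ * y) (nbr-to-mid u j) ⟩
        d u * ½ + ½ * (ℕ→ℚ 2 * nbr u (λ x → h x a) + ℕ→ℚ 2 * nbr u (λ x → h x b) + d u * γ j)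
          ≡⟨ cong₂ (λ y z → d u * ½ + ½ * (ℕ→ℚ 2 * y + ℕ→ℚ 2 * z + d u * γ j)) (nbr-h u a) (nbr-h u b) ⟩
        d u * ½ + ½ * (ℕ→ℚ 2 * nbr-h-a + ℕ→ℚ 2 * nbr-h-b + d u * γ j)
          ∎
      lemma : ∀ c x y p q e f g →
              c + (c * (½ + ½ * (ℕ→ℚ 2 * x + ℕ→ℚ 2 * y + (e - 1ℚ - f - g)))
                   + (c * ½ + ½ * (ℕ→ℚ 2 * (c * x - c + p * e) + ℕ→ℚ 2 * (c * y - c + q * e) + c * (e - 1ℚ - f - g)))
                   - (p + q) * e)
              ≡ c * (ℕ→ℚ 2 * x + ℕ→ℚ 2 * y + (e - 1ℚ - f - g))
      lemma = solve-∀ ℚ-ring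
      step : org u ≢ mid j → deg sH (org u) * h′ (org u) (mid j) ≡ deg sH (org u) + nbrSum sH (org u) (λ x → h′ x (mid j))
      step _ = sym (begin
        deg sH (org u) + nbrSum sH (org u) (λ x → h′ x (mid j))
          ≡⟨ cong₂ _+_ (deg-org u) (nbrSum-org u (λ x → h′ x (mid j))) ⟩
        d u + ∑[ k < E ] (incidence u k * h′ (mid k) (mid j))
          ≡⟨ cong (d u +_) ∑-incidence-h′ ⟩
        d u + (d u * F u + nbr u F - (δ u a + δ u b) * vol)
          ≡⟨ cong (λ y → d u + (d u * F u + y - (δ u a + δ u b) * vol)) nbr-F ⟩
        d u + (d u * F u + (d u * ½ + ½ * (ℕ→ℚ 2 * nbr-h-a + ℕ→ℚ 2 * nbr-h-b + d u * γ j)) - (δ u a + δ u b) * vol)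
          ≡⟨ lemma (d u) (h u a) (h u b) (δ u a) (δ u b) vol (h a b) (h b a) ⟩
        d u * to-mid u j
          ≡⟨ cong₂ _*_ (deg-org u) (h′-org-mid u j) ⟨
        deg sH (org u) * h′ (org u) (mid j)
          ∎)

    ht′ : HittingTimes sH h′
    ht′ z t = vertex-ind (λ z → FirstStepAt z t)
                         (λ u → vertex-ind (FirstStepAt (org u)) (first-step-org-org u) (first-step-org-mid u) t)
                         (λ k → first-step-mid k t) z

    kemeny-mid : ∀ {K′} → (∀ x → ∑[ t < n ℕ.+ E ] (deg sH t * h′ (org x) t) ≡ K′) →
                 ∀ k → ∑[ t < n ℕ.+ E ] (deg sH t * h′ (mid k) t) ≡ K′
    kemeny-mid {K′} kemeny-org k = begin
      ∑[ t < n ℕ.+ E ] (deg sH t * h′ (mid k) t)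
        ≡⟨ sum-cong-≗ (λ t → trans (cong (deg sH t *_) (h′-mid k t)) (lemma₁ (deg sH t) (δ (mid k) t) (from-mid k t))) ⟩
      ∑[ t < n ℕ.+ E ] (D t - δ (mid k) t * D t)
        ≡⟨ ∑-distrib-- D (λ t → δ (mid k) t * D t) ⟩
      sum D - ∑[ t < n ℕ.+ E ] (δ (mid k) t * D t)
        ≡⟨ cong₂ _-_ ∑-D (∑-δˡ (mid k) D) ⟩
      (vol + vol + ½ * K′ + ½ * K′) - deg sH (mid k) * from-mid k (mid k)
        ≡⟨ cong (λ y → (vol + vol + ½ * K′ + ½ * K′) - y) (cong₂ _*_ (deg-mid k) (from-mid-return k)) ⟩
      (vol + vol + ½ * K′ + ½ * K′) - ℕ→ℚ 2 * vol
        ≡⟨ lemma₂ vol K′ ⟩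
      K′ ∎
      where
      open ≡-Reasoning
      a b : Fin n
      a = end₁ k
      b = end₂ k
      D : Fin (n ℕ.+ E) → ℚ
      D t = deg sH t * from-mid k t
      lemma₁ : ∀ g p m → g * ((1ℚ - p) * m) ≡ g * m - p * (g * m)
      lemma₁ = solve-∀ ℚ-ring
      lemma₂ : ∀ v x → (v + v + ½ * x + ½ * x) - ℕ→ℚ 2 * v ≡ x
      lemma₂ = solve-∀ ℚ-ring
      lemma₃ : ∀ g x y → g * (1ℚ + ½ * (x + y)) ≡ g + ½ * (g * x) + ½ * (g * y)
      lemma₃ = solve-∀ ℚ-ring
      ∑-D : sum D ≡ vol + vol + ½ * K′ + ½ * K′
      ∑-D = begin
        sum D
          ≡⟨ sum-cong-≗ (λ t → trans (lemma₃ (deg sH t) (from-org a t) (from-org b t))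
                                     (sym (cong₂ (λ x y → deg sH t + ½ * (deg sH t * x) + ½ * (deg sH t * y)) (h′-org a t) (h′-org b t)))) ⟩
        ∑[ t < n ℕ.+ E ] (deg sH t + ½ * (deg sH t * h′ (org a) t) + ½ * (deg sH t * h′ (org b) t))
          ≡⟨ trans (∑-distrib-+ (λ t → deg sH t + ½ * (deg sH t * h′ (org a) t)) (λ t → ½ * (deg sH t * h′ (org b) t)))
                   (cong (_+ ∑[ t < n ℕ.+ E ] (½ * (deg sH t * h′ (org b) t))) (∑-distrib-+ (deg sH) (λ t → ½ * (deg sH t * h′ (org a) t)))) ⟩
        sum (deg sH) + ∑[ t < n ℕ.+ E ] (½ * (deg sH t * h′ (org a) t)) + ∑[ t < n ℕ.+ E ] (½ * (deg sH t * h′ (org b) t))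
          ≡⟨ cong₂ (λ x y → sum (deg sH) + x + y) (sym (*-distribˡ-sum ½ (λ t → deg sH t * h′ (org a) t))) (sym (*-distribˡ-sum ½ (λ t → deg sH t * h′ (org b) t))) ⟩
        sum (deg sH) + ½ * ∑[ t < n ℕ.+ E ] (deg sH t * h′ (org a) t) + ½ * ∑[ t < n ℕ.+ E ] (deg sH t * h′ (org b) t)
          ≡⟨ cong₂ (λ x y → sum (deg sH) + ½ * x + ½ * y) (kemeny-org a) (kemeny-org b) ⟩
        sum (deg sH) + ½ * K′ + ½ * K′
          ≡⟨ cong (λ x → x + ½ * K′ + ½ * K′) ∑-deg-sH ⟩
        vol + vol + ½ * K′ + ½ * K′
          ∎

    ∑-deg-h′-org-org : ∀ u → ∑[ v < n ] (deg sH (org v) * h′ (org u) (org v)) ≡ ℕ→ℚ 4 * ∑[ v < n ] (d v * h u v)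
    ∑-deg-h′-org-org u = trans (sum-cong-≗ pointwise) (sym (*-distribˡ-sum (ℕ→ℚ 4) (λ v → d v * h u v)))
      where
      lemma : ∀ x y → x * (ℕ→ℚ 4 * y) ≡ ℕ→ℚ 4 * (x * y)
      lemma = solve-∀ ℚ-ring
      pointwise : ∀ v → deg sH (org v) * h′ (org u) (org v) ≡ ℕ→ℚ 4 * (d v * h u v)
      pointwise v = trans (cong₂ _*_ (deg-org v) (h′-org-org u v)) (lemma (d v) (h u v))

    ∑-deg-h′-org-mid : ∀ u → ∑[ j < E ] (deg sH (mid j) * h′ (org u) (mid j))
                             ≡ ℕ→ℚ 4 * ∑[ v < n ] (d v * h u v) + ℕ→ℚ E * (ℕ→ℚ 2 * (vol - 1ℚ)) - ℕ→ℚ 2 * (ℕ→ℚ n * vol - vol)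
    ∑-deg-h′-org-mid u = trans (sum-cong-≗ pointwise) (trans (∑-distrib-- P Q) (cong₂ _-_ ∑-P ∑-Q))
      where
      open ≡-Reasoning
      P Q : Fin E → ℚ
      P j = ℕ→ℚ 4 * (h u (end₁ j) + h u (end₂ j)) + ℕ→ℚ 2 * (vol - 1ℚ)
      Q j = ℕ→ℚ 2 * (h (end₁ j) (end₂ j) + h (end₂ j) (end₁ j))
      lemma : ∀ v x y p q → ℕ→ℚ 2 * (ℕ→ℚ 2 * x + ℕ→ℚ 2 * y + (v - 1ℚ - p - q))
                            ≡ ℕ→ℚ 4 * (x + y) + ℕ→ℚ 2 * (v - 1ℚ) - ℕ→ℚ 2 * (p + q)
      lemma = solve-∀ ℚ-ring
      pointwise : ∀ j → deg sH (mid j) * h′ (org u) (mid j) ≡ P j - Q j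
      pointwise j = trans (cong₂ _*_ (deg-mid j) (h′-org-mid u j))
                          (lemma vol (h u (end₁ j)) (h u (end₂ j)) (h (end₁ j) (end₂ j)) (h (end₂ j) (end₁ j)))
      ∑-P : sum P ≡ ℕ→ℚ 4 * ∑[ v < n ] (d v * h u v) + ℕ→ℚ E * (ℕ→ℚ 2 * (vol - 1ℚ))
      ∑-P = begin
        sum P
          ≡⟨ ∑-distrib-+ (λ j → ℕ→ℚ 4 * (h u (end₁ j) + h u (end₂ j))) (λ _ → ℕ→ℚ 2 * (vol - 1ℚ)) ⟩
        ∑[ j < E ] (ℕ→ℚ 4 * (h u (end₁ j) + h u (end₂ j))) + ∑[ j < E ] (ℕ→ℚ 2 * (vol - 1ℚ))
          ≡⟨ cong₂ _+_ (sym (*-distribˡ-sum (ℕ→ℚ 4) (λ j → h u (end₁ j) + h u (end₂ j)))) (∑-const E _) ⟩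
        ℕ→ℚ 4 * ∑[ j < E ] (h u (end₁ j) + h u (end₂ j)) + ℕ→ℚ E * (ℕ→ℚ 2 * (vol - 1ℚ))
          ≡⟨ cong (λ y → ℕ→ℚ 4 * y + ℕ→ℚ E * (ℕ→ℚ 2 * (vol - 1ℚ))) (∑-d* (h u)) ⟨
        ℕ→ℚ 4 * ∑[ v < n ] (d v * h u v) + ℕ→ℚ E * (ℕ→ℚ 2 * (vol - 1ℚ))
          ∎
      ∑-Q : sum Q ≡ ℕ→ℚ 2 * (ℕ→ℚ n * vol - vol)
      ∑-Q = trans (sym (*-distribˡ-sum (ℕ→ℚ 2) (λ j → h (end₁ j) (end₂ j) + h (end₂ j) (end₁ j)))) (cong (ℕ→ℚ 2 *_) foster)

    module Kemeny {κ : ℚ} (K : ∀ i → sumV (graph n es) (λ j → deg (graph n es) j * h i j) ≡ ℕ→ℚ (2 ℕ.* E) * κ) where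

      κ′ : ℚ
      κ′ = ℕ→ℚ 4 * κ + (circuitRank (graph n es) - ½)

      ∑-d-h : ∀ i → ∑[ j < n ] (d j * h i j) ≡ vol * κ
      ∑-d-h i = trans (sum-cong-≗ λ j → cong (_* h i j) (sym (deg≡d j))) (trans (sym (sumV-∑ (graph n es) _)) (trans (K i) (cong (_* κ) (ℕ→ℚ-* 2 E))))

      kemeny-org : ∀ u → ∑[ t < n ℕ.+ E ] (deg sH t * h′ (org u) t) ≡ (vol + vol) * κ′
      kemeny-org u = begin
        ∑[ t < n ℕ.+ E ] (deg sH t * h′ (org u) t)
          ≡⟨ ∑-↑ n E (λ t → deg sH t * h′ (org u) t) ⟩
        ∑[ v < n ] (deg sH (org v) * h′ (org u) (org v)) + ∑[ j < E ] (deg sH (mid j) * h′ (org u) (mid j))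
          ≡⟨ cong₂ _+_ (∑-deg-h′-org-org u) (∑-deg-h′-org-mid u) ⟩
        ℕ→ℚ 4 * S + (ℕ→ℚ 4 * S + ℕ→ℚ E * (ℕ→ℚ 2 * (vol - 1ℚ)) - ℕ→ℚ 2 * (ℕ→ℚ n * vol - vol))
          ≡⟨ cong (λ y → ℕ→ℚ 4 * y + (ℕ→ℚ 4 * y + ℕ→ℚ E * (ℕ→ℚ 2 * (vol - 1ℚ)) - ℕ→ℚ 2 * (ℕ→ℚ n * vol - vol))) (∑-d-h u) ⟩
        ℕ→ℚ 4 * (vol * κ) + (ℕ→ℚ 4 * (vol * κ) + ℕ→ℚ E * (ℕ→ℚ 2 * (vol - 1ℚ)) - ℕ→ℚ 2 * (ℕ→ℚ n * vol - vol))
          ≡⟨ lemma (ℕ→ℚ E) (ℕ→ℚ n) κ ⟩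
        (vol + vol) * κ′
          ∎
        where
        open ≡-Reasoning
        S : ℚ
        S = ∑[ v < n ] (d v * h u v)
        lemma : ∀ e m k → let v = ℕ→ℚ 2 * e in
                ℕ→ℚ 4 * (v * k) + (ℕ→ℚ 4 * (v * k) + e * (ℕ→ℚ 2 * (v - 1ℚ)) - ℕ→ℚ 2 * (m * v - v))
                ≡ (v + v) * (ℕ→ℚ 4 * k + (e - m + ℕ→ℚ 1 - ½))
        lemma = solve-∀ ℚ-ring

      kemeny : ∀ z → sumV sH (λ t → deg sH t * h′ z t) ≡ ℕ→ℚ (2 ℕ.* nEdges sH) * κ′
      kemeny z = begin
        sumV sH (λ t → deg sH t * h′ z t)          ≡⟨ sumV-∑ sH (λ t → deg sH t * h′ z t) ⟩
        ∑[ t < n ℕ.+ E ] (deg sH t * h′ z t)       ≡⟨ vertex-ind (λ z → ∑[ t < n ℕ.+ E ] (deg sH t * h′ z t) ≡ (vol + vol) * κ′)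
                                                                 kemeny-org (kemeny-mid kemeny-org) z ⟩
        (vol + vol) * κ′                           ≡⟨ cong (_* κ′) vol-sH ⟨
        ℕ→ℚ (2 ℕ.* nEdges sH) * κ′                 ∎
        where
        open ≡-Reasoning
        vol-sH : ℕ→ℚ (2 ℕ.* nEdges sH) ≡ vol + vol
        vol-sH = begin
          ℕ→ℚ (2 ℕ.* nEdges sH)      ≡⟨ cong (λ m → ℕ→ℚ (2 ℕ.* m)) nEdges-sH ⟩
          ℕ→ℚ (2 ℕ.* (2 ℕ.* E))      ≡⟨ trans (ℕ→ℚ-* 2 (2 ℕ.* E)) (cong (ℕ→ℚ 2 *_) (ℕ→ℚ-* 2 E)) ⟩
          ℕ→ℚ 2 * vol                ≡⟨ lemma vol ⟩
          vol + vol                  ∎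
          where
          lemma : ∀ v → ℕ→ℚ 2 * v ≡ v + v
          lemma = solve-∀ ℚ-ring

kemeny-subdivide : ∀ H κ → IsKemeny H κ → IsKemeny (subdivide H) (ℕ→ℚ 4 * κ + (circuitRank H - ½))
kemeny-subdivide (graph n es) κ (h , ht , K) = h′ , ht′ , kemeny
  where
  open Subdivision es
  open HittingTimesOnSubdivision ht
  open Kemeny K

circuitRank-subdivide : ∀ H → circuitRank (subdivide H) ≡ circuitRank H
circuitRank-subdivide (graph n es) = begin
  ℕ→ℚ (nEdges sH) - ℕ→ℚ (n ℕ.+ E) + ℕ→ℚ 1   ≡⟨ cong₂ (λ x y → x - y + ℕ→ℚ 1) (trans (cong ℕ→ℚ nEdges-sH) (ℕ→ℚ-* 2 E)) (ℕ→ℚ-+ n E) ⟩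
  ℕ→ℚ 2 * ℕ→ℚ E - (ℕ→ℚ n + ℕ→ℚ E) + ℕ→ℚ 1 ≡⟨ lemma (ℕ→ℚ E) (ℕ→ℚ n) ⟩
  ℕ→ℚ E - ℕ→ℚ n + ℕ→ℚ 1                   ∎
  where
  open ≡-Reasoning
  open EdgeList es
  open Subdivision es
  lemma : ∀ e m → ℕ→ℚ 2 * e - (m + e) + ℕ→ℚ 1 ≡ e - m + ℕ→ℚ 1
  lemma = solve-∀ ℚ-ring

circuitRank-iterSub : ∀ m G → circuitRank (iterSub m G) ≡ circuitRank G
circuitRank-iterSub zero    G = refl
circuitRank-iterSub (suc m) G = trans (circuitRank-subdivide (iterSub m G)) (circuitRank-iterSub m G)

kemeny-iterSub-step : ∀ G m κ → IsKemeny (iterSub m G) κ →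
                      IsKemeny (iterSub (suc m) G) (ℕ→ℚ 4 * κ + (circuitRank G - ½))
kemeny-iterSub-step G m κ K =
  subst (λ r → IsKemeny (iterSub (suc m) G) (ℕ→ℚ 4 * κ + (r - ½))) (circuitRank-iterSub m G)
        (kemeny-subdivide (iterSub m G) κ K)

kemeny-iterSub : ∀ G m κ → IsKemeny G κ →
                 IsKemeny (iterSub m G) (ℕ→ℚ (4 ^ m) * κ + ((ℕ→ℚ (4 ^ m) - ℕ→ℚ 1) * 1/ (ℕ→ℚ 3)) * (circuitRank G - ½))
kemeny-iterSub G zero    κ K = subst (IsKemeny G) (lemma κ (circuitRank G - ½)) K
  where
  lemma : ∀ k c → k ≡ ℕ→ℚ 1 * k + ((ℕ→ℚ 1 - ℕ→ℚ 1) * 1/ (ℕ→ℚ 3)) * c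
  lemma = solve-∀ ℚ-ring
kemeny-iterSub G (suc m) κ K =
  subst (IsKemeny (iterSub (suc m) G)) recurrence (kemeny-iterSub-step G m _ (kemeny-iterSub G m κ K))
  where
  lemma : ∀ p k c → ℕ→ℚ 4 * (p * k + ((p - ℕ→ℚ 1) * 1/ (ℕ→ℚ 3)) * c) + c
                    ≡ (ℕ→ℚ 4 * p) * k + ((ℕ→ℚ 4 * p - ℕ→ℚ 1) * 1/ (ℕ→ℚ 3)) * c
  lemma = solve-∀ ℚ-ring
  recurrence : ℕ→ℚ 4 * (ℕ→ℚ (4 ^ m) * κ + ((ℕ→ℚ (4 ^ m) - ℕ→ℚ 1) * 1/ (ℕ→ℚ 3)) * (circuitRank G - ½)) + (circuitRank G - ½)
               ≡ ℕ→ℚ (4 ^ suc m) * κ + ((ℕ→ℚ (4 ^ suc m) - ℕ→ℚ 1) * 1/ (ℕ→ℚ 3)) * (circuitRank G - ½)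
  recurrence = trans (lemma (ℕ→ℚ (4 ^ m)) κ (circuitRank G - ½))
                     (cong (λ p → p * κ + ((p - ℕ→ℚ 1) * 1/ (ℕ→ℚ 3)) * (circuitRank G - ½)) (sym (ℕ→ℚ-* 4 (4 ^ m))))

-- Simplicity, connectedness and 2 ≤ N G only guarantee that the Kemeny constants exist;
-- the identities hold for every multigraph once hitting times are given.
theorem2 : (G : Graph) → Simple G → Connected G → 2 ≤ N G →
    ((n : ℕ) → (κ : ℚ) → IsKemeny (iterSub n G) κ →
      IsKemeny (iterSub (suc n) G) (ℕ→ℚ 4 * κ + (circuitRank G - ½)))
    × ((n : ℕ) → (κ : ℚ) → IsKemeny G κ →
      IsKemeny (iterSub n G)
        (ℕ→ℚ (4 ^ n) * κ + ((ℕ→ℚ (4 ^ n) - ℕ→ℚ 1) * 1/ (ℕ→ℚ 3)) * (circuitRank G - ½)))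
theorem2 G _ _ _ = kemeny-iterSub-step G , kemeny-iterSub G
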